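{- Let $P=\langle Q,\mathrm{Instrs},\delta\rangle$ be a single process, let $\mathcal{G}^\iota=\langle C,C_A,C_B,\to\rangle$ be the TSO game of the single-process program $\langle P\rangle$, and let $\mathcal{G}^{\mathcal V}=\langle \mathcal V,\mathcal V_A,\mathcal V_B,\to_{\mathrm{view}}\rangle$ be the view game. Then the relation $R=\{(c,\mathrm{view}(c))\mid c\in C\}$ is a bisimulation between $\mathcal{G}^\iota$ and $\mathcal{G}^{\mathcal V}$ with respect to the colourings $\lambda^\iota:C\to\mathcal V$, $c\mapsto\mathrm{view}(c)$, and $\lambda^{\mathcal V}=\mathrm{id}_{\mathcal V}$.
   Context: Let $V$ be a finite data domain and $X$ a finite set of shared variables over $V$. Instructions $\mathrm{Instrs}$ are $\mathrm{rd}(x,d)$, $\mathrm{wr}(x,d)$ ($x\in X,d\in V$), $\mathrm{skip}$, $\mathrm{mf}$. For a single process, a TSO configuration is $c=\langle q,b,m\rangle$ with $q\in Q$, buffer $b\in(X\times V)^*$ (new messages added on the left, oldest on the right) and memory $m:X\to V$. Transitions: $\mathrm{rd}(x,d)$ along an edge $q\xrightarrow{\mathrm{rd}(x,d)}q'$ is enabled if the most recent buffer message on $x$ is $\langle x,d\rangle$, or if there is no buffer message on $x$ and $m(x)=d$; $\mathrm{wr}(x,d)$ moves to $q'$ and prepends $\langle x,d\rangle$ to $b$; $\mathrm{skip}$ only changes the state; $\mathrm{mf}$ is enabled only if $b=\varepsilon$; an update removes the oldest message $\langle x,d\rangle$ from $b$ and sets $m(x)=d$. $c\xrightarrow{\mathrm{up}^*}c'$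 means zero or more updates. The TSO game $\mathcal{G}^\iota$: $C_A=\{c_A\}$, $C_B=\{c_B\}$ are copies of the configurations, $C=C_A\cup C_B$; the process player moves $c_A\xrightarrow{i}c'_B$ for each instruction transition $c\xrightarrow{i}c'$; the update player moves $c_B\xrightarrow{\mathrm{up}^*}c'_A$ whenever $c\xrightarrow{\mathrm{up}^*}c'$. The view of $c=\langle q,b,m\rangle$ is $\mathrm{view}(c)=\langle q,\mathrm{val},f\rangle$, where $\mathrm{val}(x)=d$ if the most recent message on $x$ in $b$ is $\langle x,d\rangle$ and $\mathrm{val}(x)=m(x)$ if there is none, and $f=\mathrm{true}$ iff $b=\varepsilon$. Extend to game configurations by $\mathrm{view}(c_X)=\mathrm{view}(c)_X$ for $X\in\{A,B\}$. The view game: $\mathcal V_X=\{\mathrm{view}(c)_X\}$, $\mathcal V=\mathcal V_A\cup\mathcal V_B$, and $v\xrightarrow{\lambda}_{\mathrm{view}}v'$ iff there are game configurations $c,c'$ of $\mathcal{G}^\iota$ with $\mathrm{view}(c)=v$, $\mathrm{view}(c')=v'$ and $c\xrightarrow{\lambda}c'$. Given games $\mathcal G,\mathcal G'$ with colourings $\lambda,\lambda'$ (functions from configurations to a set of colours), a bisimulation is a relation $R\subseteq C\times C'$ such that for all $(c_1,c_2)\in R$: $\lambda(c_1)=\lambda'(c_2)$; for every transition $c_1\xrightarrow{l}c_3$ there is $c_2\xrightarrow{l}c_4$ with $(c_3,c_4)\in R$; and for every transition $c_2\xrightarrow{l}c_4$ there is $c_1\xrightarrow{l}c_3$ with $(c_3,c_4)\in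 R$. -}

module Defs where

open import Data.Nat using (ℕ)
open import Data.Fin using (Fin; _≟_)
open import Data.Vec using (Vec; lookup; tabulate; _[_]≔_)
open import Data.List using (List; []; _∷_; _∷ʳ_)
open import Data.Maybe using (Maybe; just; nothing; maybe′)
open import Data.Product using (_×_; _,_; ∃)
open import Data.Bool using (Bool; true; false)
open import Relation.Nullary using (yes; no)
open import Relation.Binary.PropositionalEquality using (_≡_)
open import Relation.Binary.Construct.Closure.ReflexiveTransitive using (Star)
open import Data.List.Membership.Propositional using (_∈_)

data Instr (nX nV : ℕ) : Set where
  rd  : Fin nX → Fin nV → Instr nX nV
  wr  : Fin nX → Fin nV → Instr nX nV
  skip : Instr nX nV
  mf   : Instr nX nV

record Process (nX nV : ℕ) : Set where
  field
    nQ : ℕ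
    δ  : List (Fin nQ × Instr nX nV × Fin nQ)

module _ {nX nV : ℕ} where

  -- buffers: newest message at the head (left), oldest at the end (right)
  Buffer : Set
  Buffer = List (Fin nX × Fin nV)

  Memory : Set
  Memory = Vec (Fin nV) nX

  latest : Buffer → Fin nX → Maybe (Fin nV)
  latest []            x = nothing
  latest ((y , d) ∷ b) x with y ≟ x
  ... | yes _ = just d
  ... | no  _ = latest b x

  isEmpty : Buffer → Bool
  isEmpty []      = true
  isEmpty (_ ∷ _) = false

  data ReadOK (b : Buffer) (m : Memory) (x : Fin nX) (d : Fin nV) : Set where
    fromBuffer : latest b x ≡ just d → ReadOK b m x d
    fromMemory : latest b x ≡ nothing → lookup m x ≡ d → ReadOK b m x d

module _ {nX nV : ℕ} (P : Process nX nV) where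
  open Process P

  record Conf : Set where
    constructor ⟨_,_,_⟩
    field
      state : Fin nQ
      buf   : Buffer {nX} {nV}
      mem   : Memory {nX} {nV}

  data Step : Conf → Instr nX nV → Conf → Set where
    rdS   : ∀ {q q' b m x d} → (q , rd x d , q') ∈ δ → ReadOK b m x d →
            Step ⟨ q , b , m ⟩ (rd x d) ⟨ q' , b , m ⟩
    wrS   : ∀ {q q' b m x d} → (q , wr x d , q') ∈ δ →
            Step ⟨ q , b , m ⟩ (wr x d) ⟨ q' , (x , d) ∷ b , m ⟩
    skipS : ∀ {q q' b m} → (q , skip , q') ∈ δ →
            Step ⟨ q , b , m ⟩ skip ⟨ q' , b , m ⟩
    mfS   : ∀ {q q' m} → (q , mf , q') ∈ δ →
            Step ⟨ q , [] , m ⟩ mf ⟨ q' , [] , m ⟩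

  data Update : Conf → Conf → Set where
    upd : ∀ {q b m x d} →
          Update ⟨ q , b ∷ʳ (x , d) , m ⟩ ⟨ q , b , m [ x ]≔ d ⟩

  Updates : Conf → Conf → Set
  Updates = Star Update

  data Side : Set where
    A B : Side

  GConf : Set
  GConf = Conf × Side

  data Label : Set where
    ins : Instr nX nV → Label
    up* : Label

  data GStep : GConf → Label → GConf → Set where
    procMove : ∀ {c i c'} → Step c i c' → GStep (c , A) (ins i) (c' , B)
    updMove  : ∀ {c c'} → Updates c c' → GStep (c , B) up* (c' , A)

  record View : Set where
    constructor ⟪_,_,_⟫
    field
      vstate : Fin nQ
      val    : Vec (Fin nV) nX
      flag   : Bool

  view : Conf → View
  view ⟨ q , b , m ⟩ =
    ⟪ q , tabulate (λ x → maybe′ (λ d → d) (lookup m x) (latest b x)) , isEmpty b ⟫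

  GView : Set
  GView = View × Side

  gview : GConf → GView
  gview (c , s) = view c , s

  VStep : GView → Label → GView → Set
  VStep v l v' = ∃ λ c → ∃ λ c' → gview c ≡ v × gview c' ≡ v' × GStep c l c'

record IsBisimulation {C C' L Col : Set}
         (_⟶_ : C → L → C → Set) (_⟶'_ : C' → L → C' → Set)
         (col : C → Col) (col' : C' → Col) (R : C → C' → Set) : Set where
  field
    colour : ∀ {c₁ c₂} → R c₁ c₂ → col c₁ ≡ col' c₂
    forth  : ∀ {c₁ c₂ l c₃} → R c₁ c₂ → (c₁ ⟶ l) c₃ →
             ∃ λ c₄ → (c₂ ⟶' l) c₄ × R c₃ c₄
    back   : ∀ {c₁ c₂ l c₄} → R c₁ c₂ → (c₂ ⟶' l) c₄ →
             ∃ λ c₃ → (c₁ ⟶ l) c₃ × R c₃ c₄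

-- A transition of the TSO game depends on a configuration only through its
-- view: a read needs the current value of its variable, a fence needs the
-- buffer to be empty, a write changes the current values in a way determined
-- by the old ones, and an update never changes a current value.  Hence two
-- configurations with the same view simulate each other.  To match a run of
-- updates ending in an empty buffer one drains the other buffer completely;
-- to match one ending in a non-empty buffer one performs no update at all.
module Submission where

open import Defs
open import Data.Nat using (ℕ)
open import Data.Fin using (Fin; _≟_)
open import Data.Vec using (lookup; _[_]≔_)
open import Data.Vec.Properties using (lookup∘tabulate; tabulate-cong; lookup∘update; lookup∘update′)
open import Data.List using ([]; _∷_; _∷ʳ_; _++_)
open import Data.List.Properties using (++-assoc; ++-identityʳ)
open import Data.Bool using (false)
open import Data.Maybe using (just; nothing; maybe′)
open import Data.Product using (_×_; _,_; ∃)
open import Data.Product.Properties using (,-injective)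
open import Relation.Nullary using (yes; no)
open import Relation.Binary.PropositionalEquality
  using (_≡_; _≗_; refl; sym; trans; cong; subst)
open import Relation.Binary.Construct.Closure.ReflexiveTransitive using (ε; _◅_; _◅◅_)

module _ {nX nV : ℕ} where

  value : Buffer {nX} {nV} → Memory {nX} {nV} → Fin nX → Fin nV
  value b m x = maybe′ (λ d → d) (lookup m x) (latest b x)

  ReadOK⇒value≡ : ∀ {b m x d} → ReadOK b m x d → value b m x ≡ d
  ReadOK⇒value≡ (fromBuffer latest≡d) rewrite latest≡d = refl
  ReadOK⇒value≡ (fromMemory latest≡∅ m[x]≡d) rewrite latest≡∅ = m[x]≡d

  value≡⇒ReadOK : ∀ b m x d → value b m x ≡ d → ReadOK b m x d
  value≡⇒ReadOK b m x d value≡d with latest b x in eq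
  ... | just _  = fromBuffer (trans eq (cong just value≡d))
  ... | nothing = fromMemory eq value≡d

  value-∷-cong : ∀ {b m b′ m′} x d → value b m ≗ value b′ m′ →
                 value ((x , d) ∷ b) m ≗ value ((x , d) ∷ b′) m′
  value-∷-cong x d agree y with x ≟ y
  ... | yes _ = refl
  ... | no  _ = agree y

  value-∷ʳ : ∀ b m x d → value (b ∷ʳ (x , d)) m ≗ value b (m [ x ]≔ d)
  value-∷ʳ [] m x d y with x ≟ y
  ... | yes refl = sym (lookup∘update x m d)
  ... | no  x≢y  = sym (lookup∘update′ (λ y≡x → x≢y (sym y≡x)) m d)
  value-∷ʳ ((z , _) ∷ b) m x d y with z ≟ y
  ... | yes _ = refl
  ... | no  _ = value-∷ʳ b m x d y

module _ {nX nV : ℕ} (P : Process nX nV) where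
  open Process P

  current : Conf P → Fin nX → Fin nV
  current ⟨ _ , b , m ⟩ = value b m

  record _≃_ (c c′ : Conf P) : Set where
    constructor same
    field
      state≡   : Conf.state c ≡ Conf.state c′
      current≡ : current c ≗ current c′
      isEmpty≡ : isEmpty (Conf.buf c) ≡ isEmpty (Conf.buf c′)

  view≡⇒≃ : ∀ {c c′} → view P c ≡ view P c′ → c ≃ c′
  view≡⇒≃ {c} {c′} eq = same (cong View.vstate eq) current≡ (cong View.flag eq)
    where
    current≡ : current c ≗ current c′
    current≡ x = trans (sym (lookup∘tabulate (current c) x))
      (trans (cong (λ v → lookup (View.val v) x) eq) (lookup∘tabulate (current c′) x))

  ≃⇒view≡ : ∀ {c c′} → c ≃ c′ → view P c ≡ view P c′
  ≃⇒view≡ (same refl current≡ isEmpty≡) rewrite isEmpty≡ | tabulate-cong current≡ = refl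

  Updates⇒≡state : ∀ {c c′} → Updates P c c′ → Conf.state c ≡ Conf.state c′
  Updates⇒≡state ε           = refl
  Updates⇒≡state (upd ◅ ups) = Updates⇒≡state ups

  Updates⇒≗current : ∀ {c c′} → Updates P c c′ → current c ≗ current c′
  Updates⇒≗current ε x = refl
  Updates⇒≗current (upd {b = b} {m} {y} {d} ◅ ups) x =
    trans (value-∷ʳ b m y d x) (Updates⇒≗current ups x)

  Updates-nonempty : ∀ {c c′} → Updates P c c′ →
                     isEmpty (Conf.buf c′) ≡ false → isEmpty (Conf.buf c) ≡ false
  Updates-nonempty ε                       c′≢[] = c′≢[]
  Updates-nonempty (upd {b = []}    ◅ _) _     = refl
  Updates-nonempty (upd {b = _ ∷ _} ◅ _) _     = refl

  Updates-≃ : ∀ {c c′ d d′} → Updates P c c′ → Updates P d d′ → c ≃ d →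
              isEmpty (Conf.buf c′) ≡ isEmpty (Conf.buf d′) → c′ ≃ d′
  Updates-≃ ups₁ ups₂ (same state≡ current≡ _) isEmpty≡ =
    same (trans (sym (Updates⇒≡state ups₁)) (trans state≡ (Updates⇒≡state ups₂)))
         (λ x → trans (sym (Updates⇒≗current ups₁ x))
                      (trans (current≡ x) (Updates⇒≗current ups₂ x)))
         isEmpty≡

  -- Updates consume the buffer from the right, so the induction keeps a prefix.
  drain : ∀ q pre b m → ∃ λ m′ → Updates P ⟨ q , pre ++ b , m ⟩ ⟨ q , pre , m′ ⟩
  drain q pre [] m rewrite ++-identityʳ pre = m , ε
  drain q pre ((x , d) ∷ b) m with drain q (pre ∷ʳ (x , d)) b m
  ... | m′ , ups = m′ [ x ]≔ d ,
    subst (λ buf → Updates P ⟨ q , buf , m ⟩ ⟨ q , pre , m′ [ x ]≔ d ⟩)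
          (++-assoc pre ((x , d) ∷ []) b) (ups ◅◅ (upd ◅ ε))

  Step-sim : ∀ {c₁ c i c′} → c₁ ≃ c → Step P c i c′ →
             ∃ λ c₃ → Step P c₁ i c₃ × c₃ ≃ c′
  Step-sim {⟨ _ , b₁ , m₁ ⟩} (same refl current≡ isEmpty≡) (rdS {q' = q′} {x = x} {d} e ok) =
    ⟨ q′ , b₁ , m₁ ⟩ , rdS e (value≡⇒ReadOK b₁ m₁ x d (trans (current≡ x) (ReadOK⇒value≡ ok))) ,
    same refl current≡ isEmpty≡
  Step-sim {⟨ _ , b₁ , m₁ ⟩} (same refl current≡ _) (wrS {q' = q′} {b = b} {m} {x} {d} e) =
    ⟨ q′ , (x , d) ∷ b₁ , m₁ ⟩ , wrS e , same refl (value-∷-cong {b = b₁} {m₁} {b} {m} x d current≡) refl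
  Step-sim {⟨ _ , b₁ , m₁ ⟩} (same refl current≡ isEmpty≡) (skipS {q' = q′} e) =
    ⟨ q′ , b₁ , m₁ ⟩ , skipS e , same refl current≡ isEmpty≡
  Step-sim {⟨ _ , [] , m₁ ⟩} (same refl current≡ _) (mfS {q' = q′} e) =
    ⟨ q′ , [] , m₁ ⟩ , mfS e , same refl current≡ refl

  Updates-sim : ∀ {c₁ c c′} → c₁ ≃ c → Updates P c c′ →
                ∃ λ c₃ → Updates P c₁ c₃ × c₃ ≃ c′
  Updates-sim {⟨ q₁ , b₁ , m₁ ⟩} {c′ = ⟨ _ , [] , _ ⟩} c₁≃c ups with drain q₁ [] b₁ m₁
  ... | m₂ , draining = ⟨ q₁ , [] , m₂ ⟩ , draining , Updates-≃ draining ups c₁≃c refl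
  Updates-sim {c′ = ⟨ _ , _ ∷ _ , _ ⟩} c₁≃c ups =
    _ , ε , Updates-≃ ε ups c₁≃c (trans (_≃_.isEmpty≡ c₁≃c) (Updates-nonempty ups refl))

  GStep-sim : ∀ {c₁ c l c′} → gview P c₁ ≡ gview P c → GStep P c l c′ →
              ∃ λ c₃ → GStep P c₁ l c₃ × gview P c₃ ≡ gview P c′
  GStep-sim eq (procMove step) with view≡ , refl ← ,-injective eq
    with c₃ , step₁ , c₃≃c′ ← Step-sim (view≡⇒≃ view≡) step
    = (c₃ , B) , procMove step₁ , cong (_, B) (≃⇒view≡ c₃≃c′)
  GStep-sim eq (updMove ups) with view≡ , refl ← ,-injective eq
    with c₃ , ups₁ , c₃≃c′ ← Updates-sim (view≡⇒≃ view≡) ups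
    = (c₃ , A) , updMove ups₁ , cong (_, A) (≃⇒view≡ c₃≃c′)

theorem2 : {nX nV : ℕ} (P : Process nX nV) →
    IsBisimulation (GStep P) (VStep P) (gview P) (λ v → v)
      (λ c v → gview P c ≡ v)
theorem2 P = record
  { colour = λ related → related
  ; forth  = λ { {c₁} refl step → _ , (c₁ , _ , refl , refl , step) , refl }
  ; back   = λ { related (_ , _ , c↦ , refl , step) → GStep-sim P (trans related (sym c↦)) step }
  }
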